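{- Let $k\ge 3$ and let $0 \le u \le 2^{k-1}-b_k$ be an integer. Then $$\deg(B_{b_k+u})=\deg(B_{a_{k-1}+u})+1 \quad\text{and}\quad \deg(B_{2^{k}-(b_k+u)})=\deg(B_{a_{k-1}+u})+1.$$
   Context: The Stern polynomials $B_n(t)\in\mathbb{Z}[t]$ are defined by $B_0=0$, $B_1=1$, $B_{2n}=tB_n$, $B_{2n+1}=B_n+B_{n+1}$. A BSD representation of an integer is a digit string $(b_{m-1}\cdots b_0)$ with $b_j\in\{1,0,-1\}$ representing $\sum b_j2^j$. A non-adjacent form (NAF) is a BSD representation in which no two adjacent digits are both nonzero; it is reduced if its leading digit is nonzero. Every positive integer has exactly one reduced NAF; its length is the NAF-bitlength. $I_k$ denotes the set of positive integers of NAF-bitlength $k$ (a set of consecutive integers, e.g. $I_1=\{1\},I_2=\{2\},I_3=\{3,4,5\}$), and for $k\ge3$, $\lvert I_k\rvert=2\lvert I_{k-2}\rvert+\lvert I_{k-1}\rvert$. Write $a_k=\min I_k$ for $k\ge1$ and $a_0=0$ (equivalently $a_1=1,a_2=2$, $a_k=2^{k-2}+a_{k-2}$). For $k\ge3$, $b_k=a_k+\lvert I_{k-2}\rvert$ is the minimum of the middle subinterval $\mathcal{B}_k$ of $I_k$, consisting of the $\lvert I_{k-1}\rvert$ elements of $I_k$ that follow its first $\lvert I_{k-2}\rvert$ elements. -}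

module Defs where

open import Data.Nat using (ℕ; zero; suc; _∸_; _^_; _%_; _/_)
import Data.Nat as ℕ
open import Data.Integer using (ℤ; +_)
import Data.Integer as ℤ
open import Data.List using (List; []; _∷_)
open import Data.Maybe using (Maybe; just; nothing)

-- Polynomials in ℤ[t] as coefficient lists, lowest degree first.
Poly : Set
Poly = List ℤ

_⊕_ : Poly → Poly → Poly
[] ⊕ q = q
(x ∷ p) ⊕ [] = x ∷ p
(x ∷ p) ⊕ (y ∷ q) = (x ℤ.+ y) ∷ (p ⊕ q)

tmul : Poly → Poly
tmul p = + 0 ∷ p

deg : Poly → Maybe ℕ
deg [] = nothing
deg (c ∷ cs) with deg cs
... | just d = just (suc d)
... | nothing with c
...   | + zero = nothing
...   | _ = just 0

-- Stern polynomials, by fuel-bounded recursion (fuel n suffices for B n)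
sternAux : ℕ → ℕ → Poly
sternAux zero _ = []
sternAux (suc f) zero = []
sternAux (suc f) (suc zero) = + 1 ∷ []
sternAux (suc f) n@(suc (suc _)) with n % 2
... | zero = tmul (sternAux f (n / 2))
... | suc _ = sternAux f (n / 2) ⊕ sternAux f (suc (n / 2))

B : ℕ → Poly
B n = sternAux n n

a : ℕ → ℕ
a zero = 0
a (suc zero) = 1
a (suc (suc zero)) = 2
a (suc (suc (suc k))) = 2 ^ (suc k) ℕ.+ a (suc k)

sizeI : ℕ → ℕ
sizeI k = a (suc k) ∸ a k

b : ℕ → ℕ
b k = a k ℕ.+ sizeI (k ∸ 2)

-- Write d n for the degree of B n. The coefficients of Stern polynomials are nonnegative, so
-- nothing cancels: d (2n) = d n + 1 and d (2n + 1) = max (d n) (d (n + 1)) for n ≥ 1, whence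
-- |d (n + 1) - d n| ≤ 1 and an odd argument never has larger degree than its even neighbours.
-- With h = 2^(k-2) and m = a (k-1) + u we have b k + u = h + m and 2^k - (b k + u) = 3h - m,
-- and the hypotheses say h/3 < m ≤ h. On this window d (h + m) = d (3h - m) = d m + 1, by
-- induction over the powers of two h: halving m lands in the window of h/2, where the
-- recurrences transport both identities, except at the single boundary point h/2 = 3k + 1,
-- m = 2k + 1, which the neighbour inequality settles.

module Submission where

open import Defs
open import Data.Nat using (ℕ; zero; suc; _+_; _*_; _∸_; _^_; _≤_; _<_; _⊔_; z≤n; s≤s; s≤s⁻¹; z<s)
open import Data.Nat.Properties
open import Data.Nat.Induction using (<-rec)
open import Data.Nat.Divisibility using (_∣_; divides; ∣m+n∣m⇒∣n; n∣m*n; ∣1⇒≡1; ∣⇒≤)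
open import Data.Nat.DivMod using (_%_; _/_; m*n%n≡0; m*n/n≡m; [m+kn]%n≡m%n; +-distrib-/-∣ʳ)
open import Data.Nat.Primality using (euclidsLemma; prime?)
open import Data.Nat.Tactic.RingSolver using (solve-∀)
import Data.Integer as ℤ
open import Data.List using ([]; _∷_)
open import Data.Maybe using (Maybe; just; nothing; fromMaybe)
import Data.Maybe as Maybe
open import Data.Product using (_×_; _,_; proj₁; proj₂; ∃)
open import Data.Sum using (inj₁; inj₂)
open import Data.Empty using (⊥-elim)
open import Relation.Nullary using (¬_)
open import Relation.Nullary.Decidable using (from-yes)
open import Relation.Binary using (tri<; tri≈; tri>)
open import Relation.Binary.PropositionalEquality

data Parity : ℕ → Set where
  even : ∀ k → Parity (k * 2)
  odd  : ∀ k → Parity (suc (k * 2))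

parity : ∀ n → Parity n
parity zero = even 0
parity (suc n) with parity n
... | even k = odd k
... | odd k  = even (suc k)

[k*2]%2≡0 : ∀ k → k * 2 % 2 ≡ 0
[k*2]%2≡0 k = m*n%n≡0 k 2

[k*2]/2≡k : ∀ k → k * 2 / 2 ≡ k
[k*2]/2≡k k = m*n/n≡m k 2

[1+k*2]%2≡1 : ∀ k → suc (k * 2) % 2 ≡ 1
[1+k*2]%2≡1 k = [m+kn]%n≡m%n 1 k 2

[1+k*2]/2≡k : ∀ k → suc (k * 2) / 2 ≡ k
[1+k*2]/2≡k k = trans (+-distrib-/-∣ʳ 1 {d = 2} (divides k refl)) ([k*2]/2≡k k)

sternAux-double : ∀ f k → sternAux (suc f) (suc k * 2) ≡ tmul (sternAux f (suc k))
sternAux-double f k rewrite [k*2]%2≡0 (suc k) | [k*2]/2≡k (suc k) = refl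

sternAux-odd : ∀ f k →
  sternAux (suc f) (suc (suc k * 2)) ≡ sternAux f (suc k) ⊕ sternAux f (suc (suc k))
sternAux-odd f k rewrite [1+k*2]%2≡1 (suc k) | [1+k*2]/2≡k (suc k) = refl

sternAux-zero : ∀ f → sternAux f 0 ≡ []
sternAux-zero zero    = refl
sternAux-zero (suc f) = refl

sternAux-fuel-irrelevant : ∀ f g n → n ≤ f → n ≤ g → sternAux f n ≡ sternAux g n
sternAux-fuel-irrelevant f g zero _ _ = trans (sternAux-zero f) (sym (sternAux-zero g))
sternAux-fuel-irrelevant (suc f) (suc g) (suc zero) _ _ = refl
sternAux-fuel-irrelevant (suc f) (suc g) (suc (suc n)) (s≤s n<f) (s≤s n<g) with parity n
... | even k = begin
  sternAux (suc f) (suc k * 2)                   ≡⟨ sternAux-double f k ⟩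
  tmul (sternAux f (suc k))                      ≡⟨ cong tmul (same (suc k) (s≤s (m≤m*n k 2))) ⟩
  tmul (sternAux g (suc k))                      ≡⟨ sternAux-double g k ⟨
  sternAux (suc g) (suc k * 2)                   ∎
  where
  open ≡-Reasoning
  same : ∀ j → j ≤ suc (k * 2) → sternAux f j ≡ sternAux g j
  same j j≤ = sternAux-fuel-irrelevant f g j (≤-trans j≤ n<f) (≤-trans j≤ n<g)
... | odd k = begin
  sternAux (suc f) (suc (suc k * 2))             ≡⟨ sternAux-odd f k ⟩
  sternAux f (suc k) ⊕ sternAux f (suc (suc k))  ≡⟨ cong₂ _⊕_ (same (suc k) (s≤s (≤-trans (m≤m*n k 2) (n≤1+n _)))) (same (suc (suc k)) (s≤s (s≤s (m≤m*n k 2)))) ⟩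
  sternAux g (suc k) ⊕ sternAux g (suc (suc k))  ≡⟨ sternAux-odd g k ⟨
  sternAux (suc g) (suc (suc k * 2))             ∎
  where
  open ≡-Reasoning
  same : ∀ j → j ≤ suc (suc (k * 2)) → sternAux f j ≡ sternAux g j
  same j j≤ = sternAux-fuel-irrelevant f g j (≤-trans j≤ n<f) (≤-trans j≤ n<g)

B-double : ∀ k → B (suc k * 2) ≡ tmul (B (suc k))
B-double k = trans (sternAux-double (suc (k * 2)) k)
  (cong tmul (sternAux-fuel-irrelevant _ _ (suc k) (s≤s (m≤m*n k 2)) ≤-refl))

B-odd : ∀ k → B (suc (suc k * 2)) ≡ B (suc k) ⊕ B (suc (suc k))
B-odd k = trans (sternAux-odd (suc (suc (k * 2))) k)
  (cong₂ _⊕_ (sternAux-fuel-irrelevant _ _ (suc k) (m≤m*n (suc k) 2) ≤-refl)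
             (sternAux-fuel-irrelevant _ _ (suc (suc k)) (s≤s (s≤s (m≤m*n k 2))) ≤-refl))

data NonNegative : Poly → Set where
  []  : NonNegative []
  _∷_ : ∀ n {p} → NonNegative p → NonNegative (ℤ.+ n ∷ p)

nonNegative-⊕ : ∀ {p q} → NonNegative p → NonNegative q → NonNegative (p ⊕ q)
nonNegative-⊕ []      q       = q
nonNegative-⊕ (n ∷ p) []      = n ∷ p
nonNegative-⊕ (n ∷ p) (m ∷ q) = (n + m) ∷ nonNegative-⊕ p q

nonNegative-sternAux : ∀ f n → NonNegative (sternAux f n)
nonNegative-sternAux zero    n             = []
nonNegative-sternAux (suc f) zero          = []
nonNegative-sternAux (suc f) (suc zero)    = 1 ∷ []
nonNegative-sternAux (suc f) (suc (suc n)) with parity n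
... | even k rewrite sternAux-double f k = 0 ∷ nonNegative-sternAux f (suc k)
... | odd k  rewrite sternAux-odd f k =
  nonNegative-⊕ (nonNegative-sternAux f (suc k)) (nonNegative-sternAux f (suc (suc k)))

infixr 6 _⊔ᴹ_

_⊔ᴹ_ : Maybe ℕ → Maybe ℕ → Maybe ℕ
nothing ⊔ᴹ y       = y
just x  ⊔ᴹ nothing = just x
just x  ⊔ᴹ just y  = just (x ⊔ y)

⊔ᴹ-identityʳ : ∀ x → x ⊔ᴹ nothing ≡ x
⊔ᴹ-identityʳ nothing  = refl
⊔ᴹ-identityʳ (just x) = refl

just-⊔ᴹ : ∀ x y → ∃ λ z → just x ⊔ᴹ y ≡ just z
just-⊔ᴹ x nothing  = x , refl
just-⊔ᴹ x (just y) = x ⊔ y , refl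

degCons : ℕ → Maybe ℕ → Maybe ℕ
degCons n       (just d) = just (suc d)
degCons zero    nothing  = nothing
degCons (suc _) nothing  = just 0

deg-∷ : ∀ n p → deg (ℤ.+ n ∷ p) ≡ degCons n (deg p)
deg-∷ n p with deg p
... | just d = refl
deg-∷ zero    p | nothing = refl
deg-∷ (suc n) p | nothing = refl

degCons-+ : ∀ n m x y → degCons (n + m) (x ⊔ᴹ y) ≡ degCons n x ⊔ᴹ degCons m y
degCons-+ n       m       (just _) (just _) = refl
degCons-+ n       zero    (just _) nothing  = refl
degCons-+ n       (suc m) (just _) nothing  = refl
degCons-+ zero    m       nothing  (just _) = refl
degCons-+ (suc n) m       nothing  (just _) = refl
degCons-+ zero    zero    nothing  nothing  = refl
degCons-+ zero    (suc m) nothing  nothing  = refl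
degCons-+ (suc n) zero    nothing  nothing  = refl
degCons-+ (suc n) (suc m) nothing  nothing  = refl

deg-tmul : ∀ p → deg (tmul p) ≡ Maybe.map suc (deg p)
deg-tmul p with deg p
... | just d  = refl
... | nothing = refl

deg-⊕ : ∀ {p q} → NonNegative p → NonNegative q → deg (p ⊕ q) ≡ deg p ⊔ᴹ deg q
deg-⊕ [] _ = refl
deg-⊕ {p} (_ ∷ _) [] = sym (⊔ᴹ-identityʳ (deg p))
deg-⊕ {ℤ.+ n ∷ p} {ℤ.+ m ∷ q} (_ ∷ p≥0) (_ ∷ q≥0) = begin
  deg (ℤ.+ (n + m) ∷ (p ⊕ q))           ≡⟨ deg-∷ (n + m) (p ⊕ q) ⟩
  degCons (n + m) (deg (p ⊕ q))         ≡⟨ cong (degCons (n + m)) (deg-⊕ p≥0 q≥0) ⟩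
  degCons (n + m) (deg p ⊔ᴹ deg q)      ≡⟨ degCons-+ n m (deg p) (deg q) ⟩
  degCons n (deg p) ⊔ᴹ degCons m (deg q) ≡⟨ cong₂ _⊔ᴹ_ (deg-∷ n p) (deg-∷ m q) ⟨
  deg (ℤ.+ n ∷ p) ⊔ᴹ deg (ℤ.+ m ∷ q)    ∎
  where open ≡-Reasoning

deg-B-double : ∀ k → deg (B (suc k * 2)) ≡ Maybe.map suc (deg (B (suc k)))
deg-B-double k = trans (cong deg (B-double k)) (deg-tmul (B (suc k)))

deg-B-odd : ∀ k → deg (B (suc (suc k * 2))) ≡ deg (B (suc k)) ⊔ᴹ deg (B (suc (suc k)))
deg-B-odd k = trans (cong deg (B-odd k))
  (deg-⊕ (nonNegative-sternAux (suc k) (suc k)) (nonNegative-sternAux (suc (suc k)) (suc (suc k))))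

B-suc-nonzero : ∀ n → ∃ λ d → deg (B (suc n)) ≡ just d
B-suc-nonzero = <-rec _ nonzero
  where
  nonzero : ∀ n → (∀ {m} → m < n → ∃ λ d → deg (B (suc m)) ≡ just d) → ∃ λ d → deg (B (suc n)) ≡ just d
  nonzero n ih with parity n
  ... | even zero = 0 , refl
  ... | even (suc k) with ih {k} (s≤s (≤-trans (m≤m*n k 2) (n≤1+n _)))
  ...   | d , eq with just-⊔ᴹ d (deg (B (suc (suc k))))
  ...     | e , ⊔ᴹ≡e = e , trans (deg-B-odd k) (trans (cong (_⊔ᴹ deg (B (suc (suc k)))) eq) ⊔ᴹ≡e)
  nonzero n ih | odd k with ih {k} (s≤s (m≤m*n k 2))
  ...   | d , eq = suc d , trans (deg-B-double k) (cong (Maybe.map suc) eq)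

-- B 0 is the zero polynomial, so degB 0 = 0 is a junk value.
degB : ℕ → ℕ
degB n = fromMaybe 0 (deg (B n))

deg-B : ∀ n → deg (B (suc n)) ≡ just (degB (suc n))
deg-B n with deg (B (suc n)) | B-suc-nonzero n
... | just _  | _      = refl
... | nothing | _ , ()

degB-double : ∀ {n} → 0 < n → degB (n * 2) ≡ suc (degB n)
degB-double {suc k} _ rewrite deg-B-double k | deg-B k = refl

degB-odd : ∀ k → degB (suc (k * 2)) ≡ degB k ⊔ degB (suc k)
degB-odd zero = refl
degB-odd (suc k) rewrite deg-B-odd k | deg-B k | deg-B (suc k) = refl

degB-lipschitz : ∀ n → degB (suc n) ≤ suc (degB n) × degB n ≤ suc (degB (suc n))
degB-lipschitz = <-rec _ lipschitz
  where
  lipschitz : ∀ n → (∀ {m} → m < n → degB (suc m) ≤ suc (degB m) × degB m ≤ suc (degB (suc m)))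
            → degB (suc n) ≤ suc (degB n) × degB n ≤ suc (degB (suc n))
  lipschitz n ih with parity n
  ... | even zero = z≤n , z≤n
  ... | even (suc k) =
    subst₂ _≤_ (sym odd≡) (cong suc (sym double≡))
      (⊔-lub (m≤n⇒m≤1+n (n≤1+n _)) (m≤n⇒m≤1+n (proj₁ (ih {suc k} (s≤s (s≤s (m≤m*n k 2))))))) ,
    subst₂ _≤_ (sym double≡) (cong suc (sym odd≡)) (s≤s (m≤m⊔n _ _))
    where
    odd≡ = degB-odd (suc k)
    double≡ = degB-double {suc k} z<s
  ... | odd k =
    subst₂ _≤_ (sym double≡) (cong suc (sym odd≡)) (s≤s (m≤n⊔m _ _)) ,
    subst₂ _≤_ (sym odd≡) (cong suc (sym double≡))
      (⊔-lub (m≤n⇒m≤1+n (proj₂ (ih {k} (s≤s (m≤m*n k 2))))) (m≤n⇒m≤1+n (n≤1+n _)))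
    where
    odd≡ = degB-odd k
    double≡ = degB-double {suc k} z<s

degB[2n+1]≤degB[2n+2] : ∀ n → degB (suc (n * 2)) ≤ degB (suc n * 2)
degB[2n+1]≤degB[2n+2] zero = z≤n
degB[2n+1]≤degB[2n+2] (suc k) = subst₂ _≤_ (sym (degB-odd (suc k))) (sym (degB-double {suc (suc k)} z<s))
  (⊔-lub (proj₂ (degB-lipschitz (suc k))) (n≤1+n _))

degB[2n+3]≤degB[2n+2] : ∀ n → degB (suc (suc n * 2)) ≤ degB (suc n * 2)
degB[2n+3]≤degB[2n+2] n = subst₂ _≤_ (sym (degB-odd (suc n))) (sym (degB-double {suc n} z<s))
  (⊔-lub (n≤1+n _) (proj₁ (degB-lipschitz (suc n))))

degB[4n+3]≡degB[2n+2] : ∀ n → degB (suc (suc (n * 2) * 2)) ≡ degB (suc n * 2)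
degB[4n+3]≡degB[2n+2] n = trans (degB-odd (suc (n * 2))) (m≤n⇒m⊔n≡n (degB[2n+1]≤degB[2n+2] n))

InWindow : ℕ → ℕ → Set
InWindow h m = h < m * 3 × m ≤ h

window⇒0<m : ∀ {h m} → InWindow h m → 0 < m
window⇒0<m {m = zero}  (() , _)
window⇒0<m {m = suc _} _ = s≤s z≤n

window⇒m<3h : ∀ {h m} → InWindow h m → m < h * 3
window⇒m<3h (lo , hi) = ≤-<-trans hi (<-≤-trans lo (*-monoˡ-≤ 3 hi))

-- Halving sends the window of g * 2 into the window of g, except for m = 2k + 1 with g = 3k + 1;
-- there k is odd as soon as g is even.
data WindowSplit (g : ℕ) : ℕ → Set where
  even     : ∀ {k} → InWindow g k → WindowSplit g (k * 2)
  odd      : ∀ {k} → InWindow g k → InWindow g (suc k) → WindowSplit g (suc (k * 2))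
  boundary : ∀ t → g ≡ suc (suc (t * 2) * 3) → InWindow g (suc t * 2)
           → WindowSplit g (suc (suc (t * 2) * 2))

¬2∣1+n*2*3 : ∀ n → ¬ 2 ∣ suc (n * 2 * 3)
¬2∣1+n*2*3 n 2∣1+6n with ∣1⇒≡1 (∣m+n∣m⇒∣n (subst (2 ∣_) (sym (n*3*2+1≡1+n*2*3 n)) 2∣1+6n) (n∣m*n (n * 3)))
  where
  n*3*2+1≡1+n*2*3 : ∀ n → n * 3 * 2 + 1 ≡ suc (n * 2 * 3)
  n*3*2+1≡1+n*2*3 = solve-∀
... | ()

windowSplit-odd : ∀ {g} k → 2 ∣ g → ¬ 3 ∣ g → k < g → g ≤ suc (k * 3) → WindowSplit g (suc (k * 2))
windowSplit-odd {g} k 2∣g 3∤g k<g g≤3k+1 with <-cmp g (k * 3)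
... | tri< g<3k _ _ = odd (g<3k , <⇒≤ k<g) (≤-trans (s≤s g≤3k+1) (n≤1+n _) , k<g)
... | tri≈ _ g≡3k _ = ⊥-elim (3∤g (divides k g≡3k))
... | tri> _ _ 3k<g with ≤-antisym g≤3k+1 3k<g | parity k
...   | refl | even t = ⊥-elim (¬2∣1+n*2*3 t 2∣g)
...   | refl | odd t  = boundary t refl (≤-trans (s≤s g≤3k+1) (n≤1+n _) , k<g)

n*2*3≡n*3*2 : ∀ n → n * 2 * 3 ≡ n * 3 * 2
n*2*3≡n*3*2 = solve-∀

windowSplit : ∀ {g m} → 2 ∣ g → ¬ 3 ∣ g → InWindow (g * 2) m → WindowSplit g m
windowSplit {g} {m} 2∣g 3∤g (lo , hi) with parity m
... | even k = even (g<3k , k≤g)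
  where
  g<3k : g < k * 3
  g<3k = *-cancelʳ-< 2 g (k * 3) (subst (g * 2 <_) (n*2*3≡n*3*2 k) lo)
  k≤g : k ≤ g
  k≤g = *-cancelʳ-≤ k g 2 hi
... | odd k = windowSplit-odd k 2∣g 3∤g (*-cancelʳ-< 2 k g hi) g≤3k+1
  where
  [1+2k]*3≡1+[1+3k]*2 : ∀ k → suc (k * 2) * 3 ≡ suc (suc (k * 3) * 2)
  [1+2k]*3≡1+[1+3k]*2 = solve-∀
  g≤3k+1 : g ≤ suc (k * 3)
  g≤3k+1 = *-cancelʳ-≤ g (suc (k * 3)) 2 (s≤s⁻¹ (subst (g * 2 <_) ([1+2k]*3≡1+[1+3k]*2 k) lo))

TranslationLaw : ℕ → Set
TranslationLaw h = ∀ m → InWindow h m → degB (h + m) ≡ suc (degB m)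

ReflectionLaw : ℕ → Set
ReflectionLaw h = ∀ m → InWindow h m → degB (h * 3 ∸ m) ≡ suc (degB m)

translation-double : ∀ {g} → 2 ∣ g → ¬ 3 ∣ g → TranslationLaw g → TranslationLaw (g * 2)
translation-double {g} 2∣g 3∤g law m w with windowSplit 2∣g 3∤g w
... | even {k} wk = begin
  degB (g * 2 + k * 2)   ≡⟨ cong degB (*-distribʳ-+ 2 g k) ⟨
  degB ((g + k) * 2)     ≡⟨ degB-double (≤-trans (window⇒0<m wk) (m≤n+m k g)) ⟩
  suc (degB (g + k))     ≡⟨ cong suc (law k wk) ⟩
  suc (suc (degB k))     ≡⟨ cong suc (degB-double (window⇒0<m wk)) ⟨
  suc (degB (k * 2))     ∎
  where open ≡-Reasoning
... | odd {k} wk wk+1 = begin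
  degB (g * 2 + suc (k * 2))          ≡⟨ cong degB (g*2+[1+k*2]≡1+[g+k]*2 g k) ⟩
  degB (suc ((g + k) * 2))            ≡⟨ degB-odd (g + k) ⟩
  degB (g + k) ⊔ degB (suc (g + k))   ≡⟨ cong (λ n → degB (g + k) ⊔ degB n) (+-suc g k) ⟨
  degB (g + k) ⊔ degB (g + suc k)     ≡⟨ cong₂ _⊔_ (law k wk) (law (suc k) wk+1) ⟩
  suc (degB k ⊔ degB (suc k))         ≡⟨ cong suc (degB-odd k) ⟨
  suc (degB (suc (k * 2)))            ∎
  where
  open ≡-Reasoning
  g*2+[1+k*2]≡1+[g+k]*2 : ∀ g k → g * 2 + suc (k * 2) ≡ suc ((g + k) * 2)
  g*2+[1+k*2]≡1+[g+k]*2 = solve-∀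
-- Here g = 6t + 4 and m = 4t + 3.
... | boundary t refl w = begin
  degB (g * 2 + m)                      ≡⟨ cong degB (2g+m≡[2y+1]*2+1 t) ⟩
  degB (suc (suc (y * 2) * 2))          ≡⟨ degB[4n+3]≡degB[2n+2] y ⟩
  degB (suc y * 2)                      ≡⟨ cong degB ([y+1]*2≡g+[t+1]*2 t) ⟩
  degB (g + suc t * 2)                  ≡⟨ law (suc t * 2) w ⟩
  suc (degB (suc t * 2))                ≡⟨ cong suc (degB[4n+3]≡degB[2n+2] t) ⟨
  suc (degB m)                          ∎
  where
  open ≡-Reasoning
  y = suc (t * 2) * 2
  2g+m≡[2y+1]*2+1 : ∀ t → suc (suc (t * 2) * 3) * 2 + suc (suc (t * 2) * 2)
                   ≡ suc (suc (suc (t * 2) * 2 * 2) * 2)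
  2g+m≡[2y+1]*2+1 = solve-∀
  [y+1]*2≡g+[t+1]*2 : ∀ t → suc (suc (t * 2) * 2) * 2 ≡ suc (suc (t * 2) * 3) + suc t * 2
  [y+1]*2≡g+[t+1]*2 = solve-∀

m≡n+o⇒m∸o≡n : ∀ {m} n o → m ≡ n + o → m ∸ o ≡ n
m≡n+o⇒m∸o≡n n o refl = m+n∸n≡m n o

[m*2]∸[1+n*2]≡1+[m∸1+n]*2 : ∀ m n → n < m → m * 2 ∸ suc (n * 2) ≡ suc ((m ∸ suc n) * 2)
[m*2]∸[1+n*2]≡1+[m∸1+n]*2 (suc m) zero    _         = refl
[m*2]∸[1+n*2]≡1+[m∸1+n]*2 (suc m) (suc n) (s≤s n<m) = [m*2]∸[1+n*2]≡1+[m∸1+n]*2 m n n<m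

reflection-double : ∀ {g} → 2 ∣ g → ¬ 3 ∣ g → ReflectionLaw g → ReflectionLaw (g * 2)
reflection-double {g} 2∣g 3∤g law m w with windowSplit 2∣g 3∤g w
... | even {k} wk = begin
  degB (g * 2 * 3 ∸ k * 2)    ≡⟨ cong (λ n → degB (n ∸ k * 2)) (n*2*3≡n*3*2 g) ⟩
  degB (g * 3 * 2 ∸ k * 2)    ≡⟨ cong degB (*-distribʳ-∸ 2 (g * 3) k) ⟨
  degB ((g * 3 ∸ k) * 2)      ≡⟨ degB-double (m<n⇒0<n∸m (window⇒m<3h wk)) ⟩
  suc (degB (g * 3 ∸ k))      ≡⟨ cong suc (law k wk) ⟩
  suc (suc (degB k))          ≡⟨ cong suc (degB-double (window⇒0<m wk)) ⟨
  suc (degB (k * 2))          ∎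
  where open ≡-Reasoning
... | odd {k} wk wk+1 = begin
  degB (g * 2 * 3 ∸ suc (k * 2))                ≡⟨ cong (λ n → degB (n ∸ suc (k * 2))) (n*2*3≡n*3*2 g) ⟩
  degB (g * 3 * 2 ∸ suc (k * 2))                ≡⟨ cong degB ([m*2]∸[1+n*2]≡1+[m∸1+n]*2 (g * 3) k k<3g) ⟩
  degB (suc ((g * 3 ∸ suc k) * 2))              ≡⟨ degB-odd (g * 3 ∸ suc k) ⟩
  degB (g * 3 ∸ suc k) ⊔ degB (suc (g * 3 ∸ suc k)) ≡⟨ cong (λ n → degB (g * 3 ∸ suc k) ⊔ degB n) (+-∸-assoc 1 k<3g) ⟨
  degB (g * 3 ∸ suc k) ⊔ degB (g * 3 ∸ k)       ≡⟨ cong₂ _⊔_ (law (suc k) wk+1) (law k wk) ⟩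
  suc (degB (suc k) ⊔ degB k)                   ≡⟨ cong suc (trans (⊔-comm (degB (suc k)) (degB k)) (sym (degB-odd k))) ⟩
  suc (degB (suc (k * 2)))                      ∎
  where
  open ≡-Reasoning
  k<3g : k < g * 3
  k<3g = <-trans (n<1+n k) (window⇒m<3h wk+1)
-- Here g = 6t + 4 and m = 4t + 3.
... | boundary t refl w = begin
  degB (g * 2 * 3 ∸ m)                  ≡⟨ cong degB (m≡n+o⇒m∸o≡n (suc (y * 2)) m (6g≡[2y+1]+m t)) ⟩
  degB (suc (y * 2))                    ≡⟨ degB-odd y ⟩
  degB y ⊔ degB (suc y)                 ≡⟨ m≥n⇒m⊔n≡m (degB[2n+3]≤degB[2n+2] (t * 8 + 4)) ⟩
  degB y                                ≡⟨ cong degB (m≡n+o⇒m∸o≡n y (suc t * 2) (3g≡y+[t+1]*2 t)) ⟨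
  degB (g * 3 ∸ suc t * 2)              ≡⟨ law (suc t * 2) w ⟩
  suc (degB (suc t * 2))                ≡⟨ cong suc (degB[4n+3]≡degB[2n+2] t) ⟨
  suc (degB m)                          ∎
  where
  open ≡-Reasoning
  y = suc (t * 8 + 4) * 2
  6g≡[2y+1]+m : ∀ t → suc (suc (t * 2) * 3) * 2 * 3 ≡ suc (suc (t * 8 + 4) * 2 * 2) + suc (suc (t * 2) * 2)
  6g≡[2y+1]+m = solve-∀
  3g≡y+[t+1]*2 : ∀ t → suc (suc (t * 2) * 3) * 3 ≡ suc (t * 8 + 4) * 2 + suc t * 2
  3g≡y+[t+1]*2 = solve-∀

¬3∣2^ : ∀ i → ¬ 3 ∣ 2 ^ i
¬3∣2^ zero 3∣1 with ∣1⇒≡1 3∣1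
... | ()
¬3∣2^ (suc i) 3∣2^[1+i] with euclidsLemma 2 (2 ^ i) (from-yes (prime? 3)) 3∣2^[1+i]
... | inj₁ 3∣2 with ∣⇒≤ 3∣2
...   | s≤s (s≤s ())
¬3∣2^ (suc i) _ | inj₂ 3∣2^i = ¬3∣2^ i 3∣2^i

powerOfTwo-induction : (P : ℕ → Set) → P 2 → (∀ {g} → 2 ∣ g → ¬ 3 ∣ g → P g → P (g * 2))
                     → ∀ i → P (2 ^ suc i)
powerOfTwo-induction P base step zero = base
powerOfTwo-induction P base step (suc i) =
  subst P (*-comm (2 ^ suc i) 2)
    (step (divides (2 ^ i) (*-comm 2 (2 ^ i))) (¬3∣2^ (suc i)) (powerOfTwo-induction P base step i))

translationLaw-2 : TranslationLaw 2
translationLaw-2 zero                (() , _)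
translationLaw-2 1                   _ = refl
translationLaw-2 2                   _ = refl
translationLaw-2 (suc (suc (suc _))) (_ , s≤s (s≤s ()))

reflectionLaw-2 : ReflectionLaw 2
reflectionLaw-2 zero                (() , _)
reflectionLaw-2 1                   _ = refl
reflectionLaw-2 2                   _ = refl
reflectionLaw-2 (suc (suc (suc _))) (_ , s≤s (s≤s ()))

translationLaw-2^ : ∀ i → TranslationLaw (2 ^ suc i)
translationLaw-2^ = powerOfTwo-induction TranslationLaw translationLaw-2 translation-double

reflectionLaw-2^ : ∀ i → ReflectionLaw (2 ^ suc i)
reflectionLaw-2^ = powerOfTwo-induction ReflectionLaw reflectionLaw-2 reflection-double

a-monotone : ∀ n → a n ≤ a (suc n)
a-monotone zero                = z≤n
a-monotone (suc zero)          = s≤s z≤n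
a-monotone (suc (suc zero))    = s≤s (s≤s z≤n)
a-monotone (suc (suc (suc n))) = +-mono-≤ (m≤m+n (2 ^ suc n) _) (a-monotone (suc n))

2^[1+n]≤a[1+n]*3 : ∀ n → 2 ^ suc n ≤ a (suc n) * 3
2^[1+n]≤a[1+n]*3 zero          = s≤s (s≤s z≤n)
2^[1+n]≤a[1+n]*3 (suc zero)    = s≤s (s≤s (s≤s (s≤s z≤n)))
2^[1+n]≤a[1+n]*3 (suc (suc n)) = begin
  2 * (2 * 2 ^ suc n)            ≡⟨ 4x≡x*3+x (2 ^ suc n) ⟩
  2 ^ suc n * 3 + 2 ^ suc n      ≤⟨ +-monoʳ-≤ (2 ^ suc n * 3) (2^[1+n]≤a[1+n]*3 n) ⟩
  2 ^ suc n * 3 + a (suc n) * 3  ≡⟨ *-distribʳ-+ 3 (2 ^ suc n) (a (suc n)) ⟨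
  (2 ^ suc n + a (suc n)) * 3    ∎
  where
  open ≤-Reasoning
  4x≡x*3+x : ∀ x → 2 * (2 * x) ≡ x * 3 + x
  4x≡x*3+x = solve-∀

b[3+i]≡2^[1+i]+a[2+i] : ∀ i → b (3 + i) ≡ 2 ^ suc i + a (2 + i)
b[3+i]≡2^[1+i]+a[2+i] i = begin
  2 ^ suc i + a (suc i) + (a (2 + i) ∸ a (suc i))   ≡⟨ +-assoc (2 ^ suc i) (a (suc i)) _ ⟩
  2 ^ suc i + (a (suc i) + (a (2 + i) ∸ a (suc i))) ≡⟨ cong (2 ^ suc i +_) (m+[n∸m]≡n (a-monotone (suc i))) ⟩
  2 ^ suc i + a (2 + i)                             ∎
  where open ≡-Reasoning

a-window : ∀ i u → b (3 + i) + u ≤ 2 ^ suc (suc i) → InWindow (2 ^ suc i) (a (2 + i) + u)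
a-window i u b+u≤4h = h<m*3 , m≤h
  where
  h = 2 ^ suc i
  m = a (2 + i) + u
  h<m*3 : h < m * 3
  h<m*3 = begin-strict
    h                ≡⟨ +-identityʳ h ⟨
    h + 0            <⟨ +-monoʳ-< h (m^n>0 2 (suc i)) ⟩
    h + h            ≡⟨ cong (h +_) (+-identityʳ h) ⟨
    2 ^ suc (suc i)  ≤⟨ 2^[1+n]≤a[1+n]*3 (suc i) ⟩
    a (2 + i) * 3    ≤⟨ *-monoˡ-≤ 3 (m≤m+n (a (2 + i)) u) ⟩
    m * 3            ∎
    where open ≤-Reasoning
  m≤h : m ≤ h
  m≤h = +-cancelˡ-≤ h m h (begin
    h + m            ≡⟨ +-assoc h (a (2 + i)) u ⟨
    h + a (2 + i) + u ≡⟨ cong (_+ u) (b[3+i]≡2^[1+i]+a[2+i] i) ⟨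
    b (3 + i) + u    ≤⟨ b+u≤4h ⟩
    h + (h + 0)      ≡⟨ cong (h +_) (+-identityʳ h) ⟩
    h + h            ∎)
    where open ≤-Reasoning

deg-B≡map-suc : ∀ {n m} → 0 < n → 0 < m → degB n ≡ suc (degB m) → deg (B n) ≡ Maybe.map suc (deg (B m))
deg-B≡map-suc {suc n} {suc m} _ _ degB≡ rewrite deg-B n | deg-B m = cong just degB≡

mainTheorem12 : (k u : ℕ) → 3 ≤ k → b k + u ≤ 2 ^ (k ∸ 1) →
    (deg (B (b k + u)) ≡ Maybe.map suc (deg (B (a (k ∸ 1) + u))))
    × (deg (B (2 ^ k ∸ (b k + u))) ≡ Maybe.map suc (deg (B (a (k ∸ 1) + u))))
mainTheorem12 (suc (suc (suc i))) u (s≤s (s≤s (s≤s _))) b+u≤4h =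
  subst (λ n → deg (B n) ≡ Maybe.map suc (deg (B m))) (sym b+u≡h+m)
    (deg-B≡map-suc (≤-trans 0<m (m≤n+m m h)) 0<m (translationLaw-2^ i m w)) ,
  subst (λ n → deg (B n) ≡ Maybe.map suc (deg (B m))) (sym 8h∸[b+u]≡3h∸m)
    (deg-B≡map-suc (m<n⇒0<n∸m (window⇒m<3h w)) 0<m (reflectionLaw-2^ i m w))
  where
  h = 2 ^ suc i
  m = a (2 + i) + u
  w = a-window i u b+u≤4h
  0<m = window⇒0<m w
  b+u≡h+m : b (3 + i) + u ≡ h + m
  b+u≡h+m = trans (cong (_+ u) (b[3+i]≡2^[1+i]+a[2+i] i)) (+-assoc h (a (2 + i)) u)
  4x≡x+x*3 : ∀ x → 2 * (2 * x) ≡ x + x * 3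
  4x≡x+x*3 = solve-∀
  8h∸[b+u]≡3h∸m : 2 ^ (3 + i) ∸ (b (3 + i) + u) ≡ h * 3 ∸ m
  8h∸[b+u]≡3h∸m = trans (cong₂ _∸_ (4x≡x+x*3 h) b+u≡h+m) ([m+n]∸[m+o]≡n∸o h (h * 3) m)
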